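{- For all integers $n\geqslant 0$ and $r\geqslant 1$, $$\sum_{k=0}^\infty p(n-rT_k) = S_r(n).$$
   Context: $p(m)$ denotes the number of integer partitions of $m$, with $p(0)=1$ and $p(m)=0$ for $m<0$. $T_k=k(k+1)/2$ is the $k$-th triangular number. For a partition $\lambda$ and $r\geqslant 1$, the least $r$-gap $g_r(\lambda)$ is the smallest positive integer whose multiplicity as a part of $\lambda$ is less than $r$ (in particular the multiplicity may be $0$; e.g. $g_1(5)=1$, $g_1(3+1+1)=2$). $S_r(n)=\sum_{\lambda\vdash n} g_r(\lambda)$ is the sum of the least $r$-gaps over all partitions of $n$. -}

module Defs where

open import Data.Nat using (ℕ; zero; suc; _+_; _*_; _∸_; _≤?_; _<?_; _/_)
open import Data.List using (List; []; _∷_; [_]; _++_; map; concatMap; filter; upTo; length; replicate)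
open import Data.Nat.ListAction using (sum)
open import Relation.Nullary using (yes; no)
open import Relation.Binary.PropositionalEquality using (_≡_)
open import Data.Nat using (_≟_)

T : ℕ → ℕ
T k = (k * suc k) / 2

-- parts m n : all partitions of n with every part ≤ m, each written as a
-- non-increasing list of positive parts.  A partition with largest allowed
-- part (suc m) is determined by the multiplicity k of (suc m) and a
-- partition of n ∸ k(suc m) into parts ≤ m.
parts : ℕ → ℕ → List (List ℕ)
parts zero zero    = [ [] ]
parts zero (suc _) = []
parts (suc m) n =
  concatMap (λ k → map (replicate k (suc m) ++_) (parts m (n ∸ k * suc m)))
            (filter (λ k → k * suc m ≤? n) (upTo (suc n)))

partitions : ℕ → List (List ℕ)
partitions n = parts n n

p : ℕ → ℕ
p n = length (partitions n)

-- p(n - t) with the convention p(negative) = 0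
pSub : ℕ → ℕ → ℕ
pSub n t with t ≤? n
... | yes _ = p (n ∸ t)
... | no  _ = 0

mult : ℕ → List ℕ → ℕ
mult a λs = length (filter (λ x → x ≟ a) λs)

gapFrom : ℕ → List ℕ → ℕ → ℕ → ℕ
gapFrom r λs zero     a = a
gapFrom r λs (suc f)  a with mult a λs <? r
... | yes _ = a
... | no  _ = gapFrom r λs f (suc a)

-- least r-gap g_r(λ): smallest positive integer with multiplicity < r.
-- Fuel length λ + 1 suffices for r ≥ 1: at most length λ positive integers
-- have multiplicity ≥ r.
g : ℕ → List ℕ → ℕ
g r λs = gapFrom r λs (suc (length λs)) 1

S : ℕ → ℕ → ℕ
S r n = sum (map (g r) (partitions n))

-- Σ_{k=0}^{∞} p(n - r T_k); terms with k > n vanish since r T_k ≥ T_k ≥ k > n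
-- (for r ≥ 1), so the sum is truncated at k = n.
lhs : ℕ → ℕ → ℕ
lhs r n = sum (map (λ k → pSub n (r * T k)) (upTo (suc n)))

-- Call λ r-full up to j when each of 1, …, j occurs at least r times in λ (every
-- λ is r-full up to 0). Then g_r(λ) = Σ_{j ≥ 0} [λ is r-full up to j], while
-- deleting r copies of each of 1, …, j maps the partitions of n that are r-full
-- up to j bijectively onto the partitions of n − r T_j; exchanging the two sums
-- gives the identity. The count is proved for partitions into parts ≤ m by
-- induction on m along the recursion defining `parts`: the multiplicity k of the
-- largest part m only matters when j = m, and then it must satisfy k ≥ r.
module Submission where

open import Defs
open import Algebra.Properties.CommutativeSemigroup using (interchange)
open import Data.Bool using (Bool; true; false; _∧_; if_then_else_) renaming (T to IsTrue)
open import Data.Bool.Properties using (∧-conicalˡ; ∧-conicalʳ)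
open import Data.Empty using (⊥-elim)
open import Data.List using (List; []; _∷_; _++_; map; concatMap; filter; upTo; applyUpTo; length; replicate)
open import Data.List.Properties using (map-++; map-cong; map-cong-local; map-∘; filter-accept; filter-reject; length-++; length-replicate)
open import Data.List.Relation.Unary.All as All using (All; []; _∷_)
open import Data.List.Relation.Unary.All.Properties using (++⁺; map⁺; concat⁺; replicate⁺; all-filter)
open import Data.Nat using (ℕ; zero; suc; _+_; _*_; _∸_; _/_; _≥_; _≤_; _<_; _≤ᵇ_; _≤?_; _<?_; _≟_; z≤n; s≤s; z<s; s<s; s≤s⁻¹)
open import Data.Nat.DivMod using (/-congˡ; +-distrib-/-∣ʳ; m*n/n≡m)
open import Data.Nat.Divisibility using (divides)
open import Data.Nat.ListAction using (sum)
open import Data.Nat.ListAction.Properties using (sum-++)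
open import Data.Nat.Properties
open import Data.Nat.Solver using (module +-*-Solver)
open import Data.Product using (_×_; _,_)
open import Data.Sum using (inj₁; inj₂)
open import Function using (_∘_)
open import Relation.Nullary using (yes; no; ¬_; Dec)
open import Relation.Nullary.Decidable using (dec-true; dec-false)
open import Relation.Binary.PropositionalEquality

open +-*-Solver using (solve; _:+_; _:*_; _:=_; con)
open ≡-Reasoning

-- Finite sums

∑< : ℕ → (ℕ → ℕ) → ℕ
∑< zero    f = 0
∑< (suc N) f = f 0 + ∑< N (λ k → f (suc k))

syntax ∑< N (λ k → e) = ∑[ k < N ] e

∑<-cong : ∀ N {f h : ℕ → ℕ} → (∀ k → k < N → f k ≡ h k) → ∑< N f ≡ ∑< N h
∑<-cong zero    e = refl
∑<-cong (suc N) e = cong₂ _+_ (e 0 z<s) (∑<-cong N (λ k k<N → e (suc k) (s<s k<N)))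

∑<-zero : ∀ N {f : ℕ → ℕ} → (∀ k → k < N → f k ≡ 0) → ∑< N f ≡ 0
∑<-zero zero    e = refl
∑<-zero (suc N) e = cong₂ _+_ (e 0 z<s) (∑<-zero N (λ k k<N → e (suc k) (s<s k<N)))

∑<-+ : ∀ a b f → ∑< (a + b) f ≡ ∑< a f + ∑[ k < b ] f (a + k)
∑<-+ zero    b f = refl
∑<-+ (suc a) b f = trans (cong (f 0 +_) (∑<-+ a b (λ k → f (suc k)))) (sym (+-assoc (f 0) _ _))

∑<-truncate : ∀ {B N} f → B ≤ N → (∀ k → B ≤ k → f k ≡ 0) → ∑< N f ≡ ∑< B f
∑<-truncate {B} {N} f B≤N vanish = begin
  ∑< N f                               ≡⟨ cong (λ M → ∑< M f) (sym (m+[n∸m]≡n B≤N)) ⟩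
  ∑< (B + (N ∸ B)) f                   ≡⟨ ∑<-+ B (N ∸ B) f ⟩
  ∑< B f + ∑[ k < N ∸ B ] f (B + k)    ≡⟨ cong (∑< B f +_) (∑<-zero (N ∸ B) (λ k _ → vanish (B + k) (m≤m+n B k))) ⟩
  ∑< B f + 0                           ≡⟨ +-identityʳ _ ⟩
  ∑< B f                               ∎

∑<-distrib-+ : ∀ N (f h : ℕ → ℕ) → ∑[ k < N ] (f k + h k) ≡ ∑< N f + ∑< N h
∑<-distrib-+ zero    f h = refl
∑<-distrib-+ (suc N) f h =
  trans (cong ((f 0 + h 0) +_) (∑<-distrib-+ N _ _))
        (interchange +-commutativeSemigroup (f 0) (h 0) _ _)

∑<-mono-≤ : ∀ N {f h : ℕ → ℕ} → (∀ k → k < N → f k ≤ h k) → ∑< N f ≤ ∑< N h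
∑<-mono-≤ zero    le = ≤-refl
∑<-mono-≤ (suc N) le = +-mono-≤ (le 0 z<s) (∑<-mono-≤ N (λ k k<N → le (suc k) (s<s k<N)))

∑<-one : ∀ N → ∑[ _ < N ] 1 ≡ N
∑<-one zero    = refl
∑<-one (suc N) = cong suc (∑<-one N)

≤ᵇ-suc : ∀ r k → (suc r ≤ᵇ suc k) ≡ (r ≤ᵇ k)
≤ᵇ-suc zero    k = refl
≤ᵇ-suc (suc r) k = refl

∑<-if-≤ᵇ : ∀ r N f → ∑[ k < N ] (if r ≤ᵇ k then f k else 0) ≡ ∑[ k < N ∸ r ] f (r + k)
∑<-if-≤ᵇ zero    N       f = refl
∑<-if-≤ᵇ (suc r) zero    f = refl
∑<-if-≤ᵇ (suc r) (suc N) f =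
  trans (∑<-cong N (λ k _ → cong (λ b → if b then f (suc k) else 0) (≤ᵇ-suc r k)))
        (∑<-if-≤ᵇ r N (λ k → f (suc k)))

sum-map-applyUpTo : ∀ N (f φ : ℕ → ℕ) → sum (map φ (applyUpTo f N)) ≡ ∑< N (φ ∘ f)
sum-map-applyUpTo zero    f φ = refl
sum-map-applyUpTo (suc N) f φ = cong (φ (f 0) +_) (sum-map-applyUpTo N (f ∘ suc) φ)

sum-map-∑<-comm : ∀ {A : Set} N (F : ℕ → A → ℕ) (xs : List A) →
  sum (map (λ x → ∑[ j < N ] F j x) xs) ≡ ∑[ j < N ] sum (map (F j) xs)
sum-map-∑<-comm N F []       = sym (∑<-zero N (λ _ _ → refl))
sum-map-∑<-comm N F (x ∷ xs) =
  trans (cong (∑[ j < N ] F j x +_) (sum-map-∑<-comm N F xs))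
        (sym (∑<-distrib-+ N (λ j → F j x) (λ j → sum (map (F j) xs))))

sum-map-concatMap : ∀ {A B : Set} (h : B → ℕ) (F : A → List B) (xs : List A) →
  sum (map h (concatMap F xs)) ≡ sum (map (λ x → sum (map h (F x))) xs)
sum-map-concatMap h F []       = refl
sum-map-concatMap h F (x ∷ xs) = begin
  sum (map h (F x ++ concatMap F xs))              ≡⟨ cong sum (map-++ h (F x) (concatMap F xs)) ⟩
  sum (map h (F x) ++ map h (concatMap F xs))      ≡⟨ sum-++ (map h (F x)) _ ⟩
  sum (map h (F x)) + sum (map h (concatMap F xs)) ≡⟨ cong (sum (map h (F x)) +_) (sum-map-concatMap h F xs) ⟩
  _                                                ∎

sum-map-filter : ∀ {P : ℕ → Set} (P? : ∀ k → Dec (P k)) (φ ψ : ℕ → ℕ) (ks : List ℕ) →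
  (∀ k → P k → φ k ≡ ψ k) → (∀ k → ¬ P k → ψ k ≡ 0) →
  sum (map φ (filter P? ks)) ≡ sum (map ψ ks)
sum-map-filter P? φ ψ []       agree vanish = refl
sum-map-filter {P} P? φ ψ (k ∷ ks) agree vanish = step (P? k)
  where
  rest : sum (map φ (filter P? ks)) ≡ sum (map ψ ks)
  rest = sum-map-filter P? φ ψ ks agree vanish
  step : Dec (P k) → sum (map φ (filter P? (k ∷ ks))) ≡ sum (map ψ (k ∷ ks))
  step (yes pk) = trans (cong (sum ∘ map φ) (filter-accept P? pk)) (cong₂ _+_ (agree k pk) rest)
  step (no ¬pk) = trans (cong (sum ∘ map φ) (filter-reject P? ¬pk))
                        (trans rest (cong (_+ sum (map ψ ks)) (sym (vanish k ¬pk))))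

sum-map-const-1 : ∀ {A : Set} (xs : List A) → sum (map (λ _ → 1) xs) ≡ length xs
sum-map-const-1 []       = refl
sum-map-const-1 (x ∷ xs) = cong suc (sum-map-const-1 xs)

sum-map-if : ∀ {A : Set} (xs : List A) (f : A → ℕ) c →
  sum (map (λ x → if c then f x else 0) xs) ≡ (if c then sum (map f xs) else 0)
sum-map-if xs       f true  = refl
sum-map-if []       f false = refl
sum-map-if (x ∷ xs) f false = sum-map-if xs f false

sub : ℕ → ℕ → (ℕ → ℕ) → ℕ
sub n t X with t ≤? n
... | yes _ = X (n ∸ t)
... | no  _ = 0

pSub≡sub : ∀ n t → pSub n t ≡ sub n t p
pSub≡sub n t with t ≤? n
... | yes _ = refl
... | no  _ = refl

sub-≤ : ∀ {n t} X → t ≤ n → sub n t X ≡ X (n ∸ t)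
sub-≤ {n} {t} X t≤n with t ≤? n
... | yes _   = refl
... | no  t≰n = ⊥-elim (t≰n t≤n)

sub-> : ∀ {n t} X → n < t → sub n t X ≡ 0
sub-> {n} {t} X n<t with t ≤? n
... | yes t≤n = ⊥-elim (<⇒≱ n<t t≤n)
... | no  _   = refl

sub-cong : ∀ n t {X Y : ℕ → ℕ} → (∀ y → y ≤ n → X y ≡ Y y) → sub n t X ≡ sub n t Y
sub-cong n t e with t ≤? n
... | yes _ = e (n ∸ t) (m∸n≤m n t)
... | no  _ = refl

sub-sub : ∀ n u t X → sub n u (λ x → sub x t X) ≡ sub n (u + t) X
sub-sub n u t X with u ≤? n
... | no u≰n = sym (sub-> X (<-≤-trans (≰⇒> u≰n) (m≤m+n u t)))
... | yes u≤n with t ≤? n ∸ u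
...   | yes t≤n∸u = trans (cong X (∸-+-assoc n u t))
                          (sym (sub-≤ X (subst (u + t ≤_) (m+[n∸m]≡n u≤n) (+-monoʳ-≤ u t≤n∸u))))
...   | no  t≰n∸u = sym (sub-> X (subst (_< u + t) (m+[n∸m]≡n u≤n) (+-monoʳ-< u (≰⇒> t≰n∸u))))

sub-if : ∀ n u t X c → sub n u (λ x → if c then sub x t X else 0) ≡ (if c then sub n (u + t) X else 0)
sub-if n u t X true = sub-sub n u t X
sub-if n u t X false with u ≤? n
... | yes _ = refl
... | no  _ = refl

T-suc : ∀ k → T (suc k) ≡ T k + suc k
T-suc k = begin
  (suc k * suc (suc k)) / 2       ≡⟨ /-congˡ expand ⟩
  (k * suc k + suc k * 2) / 2     ≡⟨ +-distrib-/-∣ʳ (k * suc k) (divides (suc k) refl) ⟩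
  T k + (suc k * 2) / 2           ≡⟨ cong (T k +_) (m*n/n≡m (suc k) 2) ⟩
  T k + suc k                     ∎
  where
  expand : suc k * suc (suc k) ≡ k * suc k + suc k * 2
  expand = solve 1 (λ k → (con 1 :+ k) :* (con 2 :+ k) := k :* (con 1 :+ k) :+ (con 1 :+ k) :* con 2) refl k

-- Partitions into bounded parts

pBounded : ℕ → ℕ → ℕ
pBounded m x = length (parts m x)

sum-map-parts-suc : ∀ m n (h : List ℕ → ℕ) → sum (map h (parts (suc m) n)) ≡
  ∑[ k < suc n ] sub n (k * suc m) (λ x → sum (map (h ∘ (replicate k (suc m) ++_)) (parts m x)))
sum-map-parts-suc m n h = begin
  sum (map h (concatMap F (filter P? (upTo (suc n)))))             ≡⟨ sum-map-concatMap h F (filter P? (upTo (suc n))) ⟩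
  sum (map (λ k → sum (map h (F k))) (filter P? (upTo (suc n))))   ≡⟨ sum-map-filter P? _ ψ (upTo (suc n)) agree vanish ⟩
  sum (map ψ (upTo (suc n)))                                       ≡⟨ sum-map-applyUpTo (suc n) (λ k → k) ψ ⟩
  ∑< (suc n) ψ                                                     ∎
  where
  F : ℕ → List (List ℕ)
  F k = map (replicate k (suc m) ++_) (parts m (n ∸ k * suc m))
  P? : ∀ k → Dec (k * suc m ≤ n)
  P? k = k * suc m ≤? n
  ψ : ℕ → ℕ
  ψ k = sub n (k * suc m) (λ x → sum (map (h ∘ (replicate k (suc m) ++_)) (parts m x)))
  agree : ∀ k → k * suc m ≤ n → sum (map h (F k)) ≡ ψ k
  agree k le = trans (cong sum (sym (map-∘ (parts m (n ∸ k * suc m))))) (sym (sub-≤ _ le))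
  vanish : ∀ k → ¬ (k * suc m ≤ n) → ψ k ≡ 0
  vanish k nle = sub-> _ (≰⇒> nle)

pBounded-suc : ∀ m n → pBounded (suc m) n ≡ ∑[ k < suc n ] sub n (k * suc m) (pBounded m)
pBounded-suc m n = begin
  length (parts (suc m) n)                ≡⟨ sym (sum-map-const-1 (parts (suc m) n)) ⟩
  sum (map (λ _ → 1) (parts (suc m) n))   ≡⟨ sum-map-parts-suc m n (λ _ → 1) ⟩
  _                                       ≡⟨ ∑<-cong (suc n) (λ k _ → sub-cong n (k * suc m) (λ y _ → sum-map-const-1 (parts m y))) ⟩
  _                                       ∎

pBounded-suc-≤ : ∀ m x → x ≤ m → pBounded (suc m) x ≡ pBounded m x
pBounded-suc-≤ m x x≤m = begin
  pBounded (suc m) x                                                   ≡⟨ pBounded-suc m x ⟩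
  sub x 0 (pBounded m) + ∑[ k < x ] sub x (suc k * suc m) (pBounded m) ≡⟨ cong₂ _+_ (sub-≤ (pBounded m) z≤n) (∑<-zero x (λ k _ → sub-> (pBounded m) (s≤s (≤-trans x≤m (m≤m+n m _))))) ⟩
  pBounded m x + 0                                                     ≡⟨ +-identityʳ _ ⟩
  pBounded m x                                                         ∎

pBounded-stable : ∀ m x → x ≤ m → pBounded m x ≡ p x
pBounded-stable zero    zero _   = refl
pBounded-stable (suc m) x    x≤ with m≤n⇒m<n∨m≡n x≤
... | inj₁ (s≤s x≤m) = trans (pBounded-suc-≤ m x x≤m) (pBounded-stable m x x≤m)
... | inj₂ refl      = refl

pBounded-suc-sub : ∀ m n t {N} → suc n ∸ t ≤ N →
  ∑[ k < N ] sub n (k * suc m + t) (pBounded m) ≡ sub n t (pBounded (suc m))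
pBounded-suc-sub m n t {N} le = begin
  ∑< N term                                                     ≡⟨ ∑<-truncate term le vanish ⟩
  ∑< (suc n ∸ t) term                                           ≡⟨ shift (t ≤? n) ⟩
  sub n t (λ x → ∑[ k < suc x ] sub x (k * suc m) (pBounded m)) ≡⟨ sub-cong n t (λ y _ → sym (pBounded-suc m y)) ⟩
  sub n t (pBounded (suc m))                                    ∎
  where
  term : ℕ → ℕ
  term k = sub n (k * suc m + t) (pBounded m)
  vanish : ∀ k → suc n ∸ t ≤ k → term k ≡ 0
  vanish k le = sub-> (pBounded m)
    (≤-trans (m≤n+m∸n (suc n) t) (subst (t + (suc n ∸ t) ≤_) (+-comm t (k * suc m)) (+-monoʳ-≤ t (≤-trans le (m≤m*n k (suc m))))))
  shift : Dec (t ≤ n) → ∑< (suc n ∸ t) term ≡ sub n t (λ x → ∑[ k < suc x ] sub x (k * suc m) (pBounded m))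
  shift (yes t≤n) = begin
    ∑< (suc n ∸ t) term                                     ≡⟨ cong (λ M → ∑< M term) (+-∸-assoc 1 t≤n) ⟩
    ∑< (suc (n ∸ t)) term                                   ≡⟨ ∑<-cong (suc (n ∸ t)) (λ k _ → trans (cong (λ u → sub n u (pBounded m)) (+-comm (k * suc m) t)) (sym (sub-sub n t (k * suc m) (pBounded m)))) ⟩
    ∑[ k < suc (n ∸ t) ] sub n t (λ x → sub x (k * suc m) (pBounded m)) ≡⟨ ∑<-cong (suc (n ∸ t)) (λ k _ → sub-≤ (λ x → sub x (k * suc m) (pBounded m)) t≤n) ⟩
    ∑[ k < suc (n ∸ t) ] sub (n ∸ t) (k * suc m) (pBounded m)            ≡⟨ sym (sub-≤ _ t≤n) ⟩
    sub n t (λ x → ∑[ k < suc x ] sub x (k * suc m) (pBounded m))       ∎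
  shift (no t≰n) = trans (cong (λ M → ∑< M term) (m≤n⇒m∸n≡0 (≰⇒> t≰n))) (sym (sub-> _ (≰⇒> t≰n)))

parts-bounded : ∀ m x → All (λ l → length l ≤ x × All (_≤ m) l) (parts m x)
parts-bounded zero    zero    = (z≤n , []) ∷ []
parts-bounded zero    (suc x) = []
parts-bounded (suc m) x       = concat⁺ (map⁺ (All.map block (all-filter (λ k → k * suc m ≤? x) (upTo (suc x)))))
  where
  extend : ∀ {k} → k * suc m ≤ x → ∀ {l} → length l ≤ x ∸ k * suc m × All (_≤ m) l →
    length (replicate k (suc m) ++ l) ≤ x × All (_≤ suc m) (replicate k (suc m) ++ l)
  extend {k} le {l} (len , bounded) =
      ≤-trans (≤-reflexive (trans (length-++ (replicate k (suc m))) (cong (_+ length l) (length-replicate k))))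
              (≤-trans (+-mono-≤ (m≤m*n k (suc m)) len) (≤-reflexive (m+[n∸m]≡n le)))
    , ++⁺ (replicate⁺ k ≤-refl) (All.map m≤n⇒m≤1+n bounded)
  block : ∀ {k} → k * suc m ≤ x → All (λ l → length l ≤ x × All (_≤ suc m) l) (map (replicate k (suc m) ++_) (parts m (x ∸ k * suc m)))
  block {k} le = map⁺ (All.map (extend le) (parts-bounded m (x ∸ k * suc m)))

-- Partitions r-full up to j

𝟙 : Bool → ℕ
𝟙 true  = 1
𝟙 false = 0

𝟙-∧ : ∀ b c → 𝟙 (b ∧ c) ≡ (if c then 𝟙 b else 0)
𝟙-∧ true  true  = refl
𝟙-∧ true  false = refl
𝟙-∧ false true  = refl
𝟙-∧ false false = refl

≤ᵇ-true : ∀ {r m} → r ≤ m → (r ≤ᵇ m) ≡ true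
≤ᵇ-true {r} {m} = dec-true (r ≤? m)

≤ᵇ-false : ∀ {r m} → m < r → (r ≤ᵇ m) ≡ false
≤ᵇ-false {r} {m} m<r = dec-false (r ≤? m) (<⇒≱ m<r)

≤ᵇ-sound : ∀ {r m} → (r ≤ᵇ m) ≡ true → r ≤ m
≤ᵇ-sound {r} {m} e = ≤ᵇ⇒≤ r m (subst IsTrue (sym e) _)

fullUpTo : ℕ → ℕ → List ℕ → Bool
fullUpTo r zero    l = true
fullUpTo r (suc j) l = fullUpTo r j l ∧ (r ≤ᵇ mult (suc j) l)

mult-cons-≢ : ∀ a x l → x ≢ a → mult a (x ∷ l) ≡ mult a l
mult-cons-≢ a x l x≢a = cong length (filter-reject (_≟ a) x≢a)

mult-cons-≡ : ∀ a l → mult a (a ∷ l) ≡ suc (mult a l)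
mult-cons-≡ a l = cong length (filter-accept (_≟ a) refl)

mult-replicate-≢ : ∀ a s k l → s ≢ a → mult a (replicate k s ++ l) ≡ mult a l
mult-replicate-≢ a s zero    l s≢a = refl
mult-replicate-≢ a s (suc k) l s≢a = trans (mult-cons-≢ a s _ s≢a) (mult-replicate-≢ a s k l s≢a)

mult-replicate-≡ : ∀ s k l → mult s (replicate k s ++ l) ≡ k + mult s l
mult-replicate-≡ s zero    l = refl
mult-replicate-≡ s (suc k) l = trans (mult-cons-≡ s _) (cong suc (mult-replicate-≡ s k l))

mult-> : ∀ {a m} l → m < a → All (_≤ m) l → mult a l ≡ 0
mult-> []      m<a []          = refl
mult-> (x ∷ l) m<a (x≤m ∷ l≤m) =
  trans (mult-cons-≢ _ x l (λ x≡a → <⇒≱ m<a (subst (_≤ _) x≡a x≤m))) (mult-> l m<a l≤m)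

fullUpTo-replicate-> : ∀ r j s k l → j < s → fullUpTo r j (replicate k s ++ l) ≡ fullUpTo r j l
fullUpTo-replicate-> r zero    s k l j<s = refl
fullUpTo-replicate-> r (suc j) s k l j<s =
  cong₂ _∧_ (fullUpTo-replicate-> r j s k l (<-trans (n<1+n j) j<s))
            (cong (r ≤ᵇ_) (mult-replicate-≢ (suc j) s k l (λ s≡sj → <-irrefl (sym s≡sj) j<s)))

fullUpTo-replicate-top : ∀ r m k l → All (_≤ m) l →
  fullUpTo r (suc m) (replicate k (suc m) ++ l) ≡ fullUpTo r m l ∧ (r ≤ᵇ k)
fullUpTo-replicate-top r m k l l≤m =
  cong₂ _∧_ (fullUpTo-replicate-> r m (suc m) k l ≤-refl)
            (cong (r ≤ᵇ_) (trans (mult-replicate-≡ (suc m) k l) (trans (cong (k +_) (mult-> l ≤-refl l≤m)) (+-identityʳ k))))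

countFull : ℕ → ℕ → ℕ → ℕ → ℕ
countFull r j m x = sum (map (𝟙 ∘ fullUpTo r j) (parts m x))

countFull-suc-below : ∀ r m j → j ≤ m → ∀ n → (∀ x → countFull r j m x ≡ sub x (r * T j) (pBounded m)) →
  countFull r j (suc m) n ≡ sub n (r * T j) (pBounded (suc m))
countFull-suc-below r m j j≤m n IH = begin
  countFull r j (suc m) n
    ≡⟨ sum-map-parts-suc m n (𝟙 ∘ fullUpTo r j) ⟩
  ∑[ k < suc n ] sub n (k * suc m) (λ x → sum (map (𝟙 ∘ fullUpTo r j ∘ (replicate k (suc m) ++_)) (parts m x)))
    ≡⟨ ∑<-cong (suc n) (λ k _ → trans (sub-cong n (k * suc m) (λ y _ → strip k y)) (sub-sub n (k * suc m) t (pBounded m))) ⟩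
  ∑[ k < suc n ] sub n (k * suc m + t) (pBounded m)
    ≡⟨ pBounded-suc-sub m n t (m∸n≤m (suc n) t) ⟩
  sub n t (pBounded (suc m))
    ∎
  where
  t : ℕ
  t = r * T j
  strip : ∀ k y → sum (map (𝟙 ∘ fullUpTo r j ∘ (replicate k (suc m) ++_)) (parts m y)) ≡ sub y t (pBounded m)
  strip k y = trans (cong sum (map-cong (λ l → cong 𝟙 (fullUpTo-replicate-> r j (suc m) k l (s≤s j≤m))) (parts m y))) (IH y)

countFull-suc-top : ∀ r m n → (∀ x → countFull r m m x ≡ sub x (r * T m) (pBounded m)) →
  countFull r (suc m) (suc m) n ≡ sub n (r * T (suc m)) (pBounded (suc m))
countFull-suc-top r m n IH = begin
  countFull r (suc m) (suc m) n
    ≡⟨ sum-map-parts-suc m n (𝟙 ∘ fullUpTo r (suc m)) ⟩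
  ∑[ k < suc n ] sub n (k * suc m) (λ x → sum (map (𝟙 ∘ fullUpTo r (suc m) ∘ (replicate k (suc m) ++_)) (parts m x)))
    ≡⟨ ∑<-cong (suc n) (λ k _ → trans (sub-cong n (k * suc m) (λ y _ → strip k y)) (sub-if n (k * suc m) t′ (pBounded m) (r ≤ᵇ k))) ⟩
  ∑[ k < suc n ] (if r ≤ᵇ k then sub n (k * suc m + t′) (pBounded m) else 0)
    ≡⟨ ∑<-if-≤ᵇ r (suc n) (λ k → sub n (k * suc m + t′) (pBounded m)) ⟩
  ∑[ k < suc n ∸ r ] sub n ((r + k) * suc m + t′) (pBounded m)
    ≡⟨ ∑<-cong (suc n ∸ r) (λ k _ → cong (λ u → sub n u (pBounded m)) (regroup k)) ⟩
  ∑[ k < suc n ∸ r ] sub n (k * suc m + t) (pBounded m)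
    ≡⟨ pBounded-suc-sub m n t (∸-monoʳ-≤ (suc n) r≤t) ⟩
  sub n t (pBounded (suc m))
    ∎
  where
  t′ t : ℕ
  t′ = r * T m
  t  = r * T (suc m)
  strip : ∀ k y → sum (map (𝟙 ∘ fullUpTo r (suc m) ∘ (replicate k (suc m) ++_)) (parts m y))
                ≡ (if r ≤ᵇ k then sub y t′ (pBounded m) else 0)
  strip k y = begin
    sum (map (𝟙 ∘ fullUpTo r (suc m) ∘ (replicate k (suc m) ++_)) (parts m y))
      ≡⟨ cong sum (map-cong-local (All.map (λ {l} (_ , l≤m) → trans (cong 𝟙 (fullUpTo-replicate-top r m k l l≤m)) (𝟙-∧ (fullUpTo r m l) (r ≤ᵇ k))) (parts-bounded m y))) ⟩
    sum (map (λ l → if r ≤ᵇ k then 𝟙 (fullUpTo r m l) else 0) (parts m y))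
      ≡⟨ sum-map-if (parts m y) (𝟙 ∘ fullUpTo r m) (r ≤ᵇ k) ⟩
    (if r ≤ᵇ k then countFull r m m y else 0)
      ≡⟨ cong (λ v → if r ≤ᵇ k then v else 0) (IH y) ⟩
    (if r ≤ᵇ k then sub y t′ (pBounded m) else 0)
      ∎
  regroup : ∀ k → (r + k) * suc m + t′ ≡ k * suc m + t
  regroup k rewrite T-suc m =
    solve 4 (λ r k s a → (r :+ k) :* s :+ r :* a := k :* s :+ r :* (a :+ s)) refl r k (suc m) (T m)
  r≤t : r ≤ t
  r≤t = subst (_≤ t) (*-identityʳ r) (*-monoʳ-≤ r (subst (1 ≤_) (sym (T-suc m)) (≤-trans (s≤s z≤n) (m≤n+m (suc m) (T m)))))

countFull≡sub : ∀ r m j → j ≤ m → ∀ n → countFull r j m n ≡ sub n (r * T j) (pBounded m)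
countFull≡sub r m       zero    _   n =
  trans (sum-map-const-1 (parts m n)) (sym (trans (cong (λ t → sub n t (pBounded m)) (*-zeroʳ r)) (sub-≤ (pBounded m) z≤n)))
countFull≡sub r (suc m) (suc j) sj≤ n with m≤n⇒m<n∨m≡n sj≤
... | inj₁ (s≤s sj≤m) = countFull-suc-below r m (suc j) sj≤m n (countFull≡sub r m (suc j) sj≤m)
... | inj₂ refl       = countFull-suc-top r m n (countFull≡sub r m m ≤-refl)

-- The least gap as a sum of fullness indicators

mult-∷ : ∀ a x l → mult a (x ∷ l) ≡ mult a (x ∷ []) + mult a l
mult-∷ a x l with x ≟ a
... | yes refl = trans (mult-cons-≡ x l) (cong (_+ mult x l) (sym (mult-cons-≡ x [])))
... | no  x≢a  = trans (mult-cons-≢ a x l x≢a) (cong (_+ mult a l) (sym (mult-cons-≢ a x [] x≢a)))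

∑<-mult-singleton-≤1 : ∀ j b x → ∑[ i < j ] mult (i + b) (x ∷ []) ≤ 1
∑<-mult-singleton-≤1 zero    b x = z≤n
∑<-mult-singleton-≤1 (suc j) b x with x ≟ b
... | yes refl = ≤-reflexive (cong₂ _+_ (mult-cons-≡ x [])
                   (∑<-zero j (λ i _ → mult-cons-≢ (suc i + x) x [] (λ x≡ → <-irrefl x≡ (s≤s (m≤n+m x i))))))
... | no  x≢b  = ≤-trans (≤-reflexive (cong₂ _+_ (mult-cons-≢ b x [] x≢b)
                                                 (∑<-cong j (λ i _ → cong (λ a → mult a (x ∷ [])) (sym (+-suc i b))))))
                         (∑<-mult-singleton-≤1 j (suc b) x)

∑<-mult-≤-length : ∀ j l → ∑[ i < j ] mult (suc i) l ≤ length l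
∑<-mult-≤-length j []      = ≤-reflexive (∑<-zero j (λ _ _ → refl))
∑<-mult-≤-length j (x ∷ l) =
  subst (_≤ suc (length l)) (sym split) (+-mono-≤ singleton (∑<-mult-≤-length j l))
  where
  singleton : ∑[ i < j ] mult (suc i) (x ∷ []) ≤ 1
  singleton = subst (_≤ 1) (∑<-cong j (λ i _ → cong (λ a → mult a (x ∷ [])) (+-comm i 1))) (∑<-mult-singleton-≤1 j 1 x)
  split : ∑[ i < j ] mult (suc i) (x ∷ l) ≡ ∑[ i < j ] mult (suc i) (x ∷ []) + ∑[ i < j ] mult (suc i) l
  split = trans (∑<-cong j (λ i _ → mult-∷ (suc i) x l)) (∑<-distrib-+ j (λ i → mult (suc i) (x ∷ [])) (λ i → mult (suc i) l))

fullUpTo⇒≤mult : ∀ {r j l} → fullUpTo r j l ≡ true → ∀ i → i < j → r ≤ mult (suc i) l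
fullUpTo⇒≤mult {r} {suc j} {l} full i i<sj with m≤n⇒m<n∨m≡n (s≤s⁻¹ i<sj)
... | inj₁ i<j  = fullUpTo⇒≤mult (∧-conicalˡ _ _ full) i i<j
... | inj₂ refl = ≤ᵇ-sound (∧-conicalʳ (fullUpTo r j l) _ full)

fullUpTo⇒≤length : ∀ {r j l} → 1 ≤ r → fullUpTo r j l ≡ true → j ≤ length l
fullUpTo⇒≤length {r} {j} {l} 1≤r full = subst (_≤ length l) (∑<-one j)
  (≤-trans (∑<-mono-≤ j (λ i i<j → ≤-trans 1≤r (fullUpTo⇒≤mult full i i<j))) (∑<-mult-≤-length j l))

fullUpTo-false : ∀ r l t j → fullUpTo r j l ≡ false → fullUpTo r (t + j) l ≡ false
fullUpTo-false r l zero    j stop = stop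
fullUpTo-false r l (suc t) j stop = cong (_∧ (r ≤ᵇ mult (suc (t + j)) l)) (fullUpTo-false r l t j stop)

gapFrom≡∑< : ∀ r l f b → fullUpTo r b l ≡ true →
  gapFrom r l f (suc b) ≡ suc b + ∑[ t < f ] 𝟙 (fullUpTo r (t + suc b) l)
gapFrom≡∑< r l zero    b full = sym (+-identityʳ (suc b))
gapFrom≡∑< r l (suc f) b full with mult (suc b) l <? r
... | yes lt = sym (trans (cong (suc b +_) (∑<-zero (suc f) (λ t _ → cong 𝟙 (fullUpTo-false r l t (suc b) stop))))
                          (+-identityʳ (suc b)))
  where
  stop : fullUpTo r (suc b) l ≡ false
  stop = cong₂ _∧_ full (≤ᵇ-false lt)
... | no ¬lt = begin
  gapFrom r l f (suc (suc b))                                   ≡⟨ gapFrom≡∑< r l f (suc b) continue ⟩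
  suc (suc b) + ∑[ t < f ] 𝟙 (fullUpTo r (t + suc (suc b)) l)   ≡⟨ cong (suc (suc b) +_) (∑<-cong f (λ t _ → cong (λ i → 𝟙 (fullUpTo r i l)) (+-suc t (suc b)))) ⟩
  suc (suc b) + ∑[ t < f ] 𝟙 (fullUpTo r (suc t + suc b) l)     ≡⟨ sym (+-suc (suc b) _) ⟩
  suc b + (1 + ∑[ t < f ] 𝟙 (fullUpTo r (suc t + suc b) l))     ≡⟨ cong (λ v → suc b + (𝟙 v + ∑[ t < f ] 𝟙 (fullUpTo r (suc t + suc b) l))) (sym continue) ⟩
  suc b + ∑[ t < suc f ] 𝟙 (fullUpTo r (t + suc b) l)           ∎
  where
  continue : fullUpTo r (suc b) l ≡ true
  continue = cong₂ _∧_ full (≤ᵇ-true (≮⇒≥ ¬lt))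

g≡∑<-fullUpTo : ∀ r n l → 1 ≤ r → length l ≤ n → g r l ≡ ∑[ j < suc n ] 𝟙 (fullUpTo r j l)
g≡∑<-fullUpTo r n l 1≤r len≤n = begin
  g r l                                         ≡⟨ gapFrom≡∑< r l (suc (length l)) 0 refl ⟩
  suc (∑[ t < suc (length l) ] χ (t + 1))       ≡⟨ cong suc (∑<-cong (suc (length l)) (λ t _ → cong χ (+-comm t 1))) ⟩
  ∑< (suc (suc (length l))) χ                   ≡⟨ ∑<-truncate χ (n≤1+n _) beyond ⟩
  ∑< (suc (length l)) χ                         ≡⟨ sym (∑<-truncate χ (s≤s len≤n) beyond) ⟩
  ∑< (suc n) χ                                  ∎
  where
  χ : ℕ → ℕ
  χ j = 𝟙 (fullUpTo r j l)
  beyond : ∀ j → suc (length l) ≤ j → χ j ≡ 0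
  beyond j len<j with fullUpTo r j l in full
  ... | true  = ⊥-elim (<⇒≱ len<j (fullUpTo⇒≤length 1≤r full))
  ... | false = refl

theorem1 : (n r : ℕ) → r ≥ 1 → lhs r n ≡ S r n
theorem1 n r 1≤r = begin
  lhs r n
    ≡⟨ sum-map-applyUpTo (suc n) (λ k → k) (λ k → pSub n (r * T k)) ⟩
  ∑[ k < suc n ] pSub n (r * T k)
    ≡⟨ ∑<-cong (suc n) (λ k _ → trans (pSub≡sub n (r * T k)) (sub-cong n (r * T k) (λ y y≤n → sym (pBounded-stable n y y≤n)))) ⟩
  ∑[ k < suc n ] sub n (r * T k) (pBounded n)
    ≡⟨ ∑<-cong (suc n) (λ k k<sn → sym (countFull≡sub r n k (s≤s⁻¹ k<sn) n)) ⟩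
  ∑[ j < suc n ] countFull r j n n
    ≡⟨ sym (sum-map-∑<-comm (suc n) (λ j → 𝟙 ∘ fullUpTo r j) (partitions n)) ⟩
  sum (map (λ l → ∑[ j < suc n ] 𝟙 (fullUpTo r j l)) (partitions n))
    ≡⟨ cong sum (map-cong-local (All.map (λ {l} (len , _) → sym (g≡∑<-fullUpTo r n l 1≤r len)) (parts-bounded n n))) ⟩
  S r n
    ∎
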